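{- Let $G$ be a finite, connected multigraph without loop edges, fix a vertex $q \in V(G)$, and let $D \in \operatorname{Div}(G)$. Then $D$ is $q$-reduced if and only if $D \in |D|_q$ and $b_q(D) < b_q(D')$ for every divisor $D' \neq D$ in $|D|_q$.
   Context: $\operatorname{Div}(G)$ is the free abelian group on $V(G)$; $\deg(D)=\sum_v D(v)$. For $f:V(G)\to\mathbb{Q}$, $\Delta(f)=\sum_v \Delta_v(f)(v)$ with $\Delta_v(f)=\sum_{\{v,w\}\in E(G)}(f(v)-f(w))$ (edges with multiplicity). $D_1\sim D_2$ iff $D_1-D_2=\Delta(f)$ for some integer-valued $f$. $|D|_q=\{E: E\sim D,\ E(v)\ge0\ \forall v\ne q\}$. For $A\subseteq V(G)$, $v\in A$, ${\operatorname{outdeg}}_A(v)$ is the number of edges from $v$ to $V(G)\setminus A$. $D$ is $q$-reduced if $D(v)\ge0$ for all $v\ne q$ and for every nonempty $A\subseteq V(G)\setminus\{q\}$ there is $v\in A$ with $D(v)<{\operatorname{outdeg}}_A(v)$. Energy pairing on degree-zero divisors: if $D_i=\Delta(f_i)$ with $f_i$ rational-valued, $\langle D_1,D_2\rangle=\sum_v f_1(v)D_2(v)$ (independent of choices). $\langle D,E\rangle_q=\langle D-\deg(D)(q),E-\deg(E)(q)\rangle$. With $\mathbf{1}=\sum_{v\in V(G)}(v)$, define $b_q(D)=\langle \mathbf{1},D\rangle_q$. -}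

module Defs where

open import Data.Nat as ℕ using (ℕ; zero; suc)
open import Data.Fin using (Fin; zero; suc)
open import Data.Bool using (Bool; true; false; if_then_else_)
open import Data.Integer as ℤ using (ℤ; +_)
open import Data.Rational as ℚ using (ℚ)
open import Data.Product using (Σ; ∃; _×_; _,_)
open import Relation.Binary.PropositionalEquality using (_≡_)
open import Relation.Nullary using (¬_)

sumℕ : ∀ {n} → (Fin n → ℕ) → ℕ
sumℕ {zero}  f = 0
sumℕ {suc n} f = f zero ℕ.+ sumℕ (λ i → f (suc i))

sumℤ : ∀ {n} → (Fin n → ℤ) → ℤ
sumℤ {zero}  f = + 0
sumℤ {suc n} f = f zero ℤ.+ sumℤ (λ i → f (suc i))

sumℚ : ∀ {n} → (Fin n → ℚ) → ℚ
sumℚ {zero}  f = ℚ.0ℚ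
sumℚ {suc n} f = f zero ℚ.+ sumℚ (λ i → f (suc i))

toℚ : ℤ → ℚ
toℚ i = i ℚ./ 1

record Multigraph (n : ℕ) : Set where
  field
    edges    : Fin n → Fin n → ℕ
    sym      : ∀ u v → edges u v ≡ edges v u
    loopless : ∀ v → edges v v ≡ 0
open Multigraph public

data Reach {n} (G : Multigraph n) (u : Fin n) : Fin n → Set where
  here : Reach G u u
  step : ∀ {v w} → Reach G u v → 1 ℕ.≤ edges G v w → Reach G u w

Connected : ∀ {n} → Multigraph n → Set
Connected {n} G = ∀ (u v : Fin n) → Reach G u v

Div : ℕ → Set
Div n = Fin n → ℤ

deg : ∀ {n} → Div n → ℤ
deg D = sumℤ D

point : ∀ {n} → Fin n → Div n
point {n} q v with q Data.Fin.≟ v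
... | Relation.Nullary.yes _ = + 1
... | Relation.Nullary.no  _ = + 0

one : ∀ {n} → Div n
one _ = + 1

_-D_ : ∀ {n} → Div n → Div n → Div n
(D -D E) v = D v ℤ.- E v

_·D_ : ∀ {n} → ℤ → Div n → Div n
(k ·D D) v = k ℤ.* D v

Δℤ : ∀ {n} → Multigraph n → (Fin n → ℤ) → Div n
Δℤ G f v = sumℤ (λ w → (+ edges G v w) ℤ.* (f v ℤ.- f w))

Δℚ : ∀ {n} → Multigraph n → (Fin n → ℚ) → Fin n → ℚ
Δℚ G f v = sumℚ (λ w → toℚ (+ edges G v w) ℚ.* (f v ℚ.- f w))

_∼⟨_⟩_ : ∀ {n} → Div n → Multigraph n → Div n → Set
D₁ ∼⟨ G ⟩ D₂ = ∃ λ (f : Fin _ → ℤ) → ∀ v → D₁ v ℤ.- D₂ v ≡ Δℤ G f v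

InLinSys : ∀ {n} → Multigraph n → Fin n → Div n → Div n → Set
InLinSys G q D E = (E ∼⟨ G ⟩ D) × (∀ v → ¬ (v ≡ q) → + 0 ℤ.≤ E v)

outdeg : ∀ {n} → Multigraph n → (Fin n → Bool) → Fin n → ℕ
outdeg G A v = sumℕ (λ w → if A w then 0 else edges G v w)

IsReduced : ∀ {n} → Multigraph n → Fin n → Div n → Set
IsReduced G q D =
  (∀ v → ¬ (v ≡ q) → + 0 ℤ.≤ D v) ×
  (∀ (A : Fin _ → Bool) → A q ≡ false → (∃ λ v → A v ≡ true) →
     ∃ λ v → (A v ≡ true) × (D v ℤ.< + outdeg G A v))

-- Energy pairing relation: Pairing G D₁ D₂ r holds iff r = Σ_v f₁(v) D₂(v)
-- for some rational-valued f₁ with Δ(f₁) = D₁.  (The paper shows this value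
-- is independent of the choice of f₁, and such f₁ exists for degree-zero D₁
-- on a connected graph.)
Pairing : ∀ {n} → Multigraph n → Div n → Div n → ℚ → Set
Pairing G D₁ D₂ r =
  ∃ λ (f₁ : Fin _ → ℚ) → (∀ v → Δℚ G f₁ v ≡ toℚ (D₁ v)) ×
                          (r ≡ sumℚ (λ v → f₁ v ℚ.* toℚ (D₂ v)))

Pairingq : ∀ {n} → Multigraph n → Fin n → Div n → Div n → ℚ → Set
Pairingq G q D E r = Pairing G (D -D (deg D ·D point q)) (E -D (deg E ·D point q)) r

Bq : ∀ {n} → Multigraph n → Fin n → Div n → ℚ → Set
Bq G q D r = Pairingq G q one D r

BqLess : ∀ {n} → Multigraph n → Fin n → Div n → Div n → Set
BqLess G q D D' = ∀ r r' → Bq G q D r → Bq G q D' r' → r ℚ.< r'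

-- If D′ = D + Δh, then b_q(D′) − b_q(D) = Σ_v (h(v) − h(q)). Indeed, write 1 − n·(q) = Δf; by the
-- symmetry Σ f·Δh = Σ h·Δf of the Laplacian, and since f is unique up to a constant (harmonic functions
-- on a connected graph are constant, by the maximum principle), the difference is Σ h·Δf. Such an f
-- exists because Δ maps onto the degree-zero vectors (Gaussian elimination on the reduced Laplacian).
-- If D is q-reduced and D′ ≠ D is effective off q, then h is minimal at q, since otherwise Dhar's
-- criterion on the minimum level set of h yields a vertex where D′ is negative; h is not constant, so
-- b_q(D′) > b_q(D). Conversely, if a set A ∌ q violates Dhar's criterion, firing A (h = −𝟙_A) gives a
-- D′ ≠ D in |D|_q with b_q(D′) − b_q(D) = −|A| < 0.

module Submission where

open import Defs renaming (sym to edges-sym)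
open import Data.Nat as ℕ using (ℕ; zero; suc)
import Data.Nat.Properties as ℕP
open import Data.Fin as Fin using (Fin; zero; suc; punchIn; punchOut)
import Data.Fin.Properties as FinP
open import Data.Bool as Bool using (Bool; true; false; if_then_else_)
open import Data.Integer as ℤ using (ℤ; +_; -[1+_])
import Data.Integer.Properties as ℤP
open import Data.Rational as ℚ using (ℚ; 0ℚ; 1ℚ; _+_; _*_; _-_; -_; _≤_; _<_)
import Data.Rational.Properties as ℚP
open import Data.Rational.Unnormalised as ℚᵘ using (mkℚᵘ; *≡*; *≤*; *<*)
import Data.Rational.Unnormalised.Properties as ℚᵘP
open import Data.Rational.Solver using (module +-*-Solver)
import Data.Integer.Solver as ℤSolver
open import Algebra.Bundles using (CommutativeRing)
import Algebra.Properties.Semiring.Sum as SemiringSum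
import Algebra.Properties.Group as GroupProperties
open import Relation.Binary.Definitions using (Reflexive; Total; Transitive)
open import Data.Product using (∃; _×_; _,_; proj₁; proj₂)
open import Data.Sum using (_⊎_; inj₁; inj₂)
open import Data.Empty using (⊥-elim)
open import Relation.Nullary using (¬_; Dec; yes; no; does; proof)
open import Relation.Nullary.Reflects using (Reflects; invert)
open import Relation.Nullary.Decidable using (¬?; _×-dec_; dec-true; dec-false)
open import Relation.Binary.PropositionalEquality
open import Function using (_∘_; _⇔_; mk⇔)

open +-*-Solver

toℚᵘ-toℚ : ∀ i → ℚ.toℚᵘ (toℚ i) ℚᵘ.≃ mkℚᵘ i 0
toℚᵘ-toℚ i = ℚP.toℚᵘ-fromℚᵘ (mkℚᵘ i 0)

toℚ-+ : ∀ a b → toℚ (a ℤ.+ b) ≡ toℚ a + toℚ b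
toℚ-+ a b = ℚP.toℚᵘ-injective (begin
  ℚ.toℚᵘ (toℚ (a ℤ.+ b))                  ≈⟨ toℚᵘ-toℚ (a ℤ.+ b) ⟩
  mkℚᵘ (a ℤ.+ b) 0                        ≈⟨ *≡* (cong (ℤ._* + 1) (cong₂ ℤ._+_ (ℤP.*-identityʳ a) (ℤP.*-identityʳ b))) ⟨
  mkℚᵘ a 0 ℚᵘ.+ mkℚᵘ b 0                  ≈⟨ ℚᵘP.+-cong (toℚᵘ-toℚ a) (toℚᵘ-toℚ b) ⟨
  ℚ.toℚᵘ (toℚ a) ℚᵘ.+ ℚ.toℚᵘ (toℚ b)      ≈⟨ ℚP.toℚᵘ-homo-+ (toℚ a) (toℚ b) ⟨
  ℚ.toℚᵘ (toℚ a + toℚ b)                  ∎)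
  where open ℚᵘP.≃-Reasoning

toℚ-* : ∀ a b → toℚ (a ℤ.* b) ≡ toℚ a * toℚ b
toℚ-* a b = ℚP.toℚᵘ-injective (begin
  ℚ.toℚᵘ (toℚ (a ℤ.* b))                  ≈⟨ toℚᵘ-toℚ (a ℤ.* b) ⟩
  mkℚᵘ (a ℤ.* b) 0                        ≈⟨ *≡* refl ⟩
  mkℚᵘ a 0 ℚᵘ.* mkℚᵘ b 0                  ≈⟨ ℚᵘP.*-cong (toℚᵘ-toℚ a) (toℚᵘ-toℚ b) ⟨
  ℚ.toℚᵘ (toℚ a) ℚᵘ.* ℚ.toℚᵘ (toℚ b)      ≈⟨ ℚP.toℚᵘ-homo-* (toℚ a) (toℚ b) ⟨
  ℚ.toℚᵘ (toℚ a * toℚ b)                  ∎)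
  where open ℚᵘP.≃-Reasoning

toℚ-neg : ∀ a → toℚ (ℤ.- a) ≡ - toℚ a
toℚ-neg a = ℚP.toℚᵘ-injective (begin
  ℚ.toℚᵘ (toℚ (ℤ.- a))    ≈⟨ toℚᵘ-toℚ (ℤ.- a) ⟩
  ℚᵘ.- mkℚᵘ a 0           ≈⟨ ℚᵘP.-‿cong (toℚᵘ-toℚ a) ⟨
  ℚᵘ.- ℚ.toℚᵘ (toℚ a)     ≈⟨ ℚP.toℚᵘ-homo‿- (toℚ a) ⟨
  ℚ.toℚᵘ (- toℚ a)        ∎)
  where open ℚᵘP.≃-Reasoning

toℚ-- : ∀ a b → toℚ (a ℤ.- b) ≡ toℚ a - toℚ b
toℚ-- a b = trans (toℚ-+ a (ℤ.- b)) (cong (λ x → toℚ a + x) (toℚ-neg b))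

toℚ-mono-≤ : ∀ {a b} → a ℤ.≤ b → toℚ a ≤ toℚ b
toℚ-mono-≤ {a} {b} a≤b = ℚP.toℚᵘ-cancel-≤ (begin
  ℚ.toℚᵘ (toℚ a)  ≃⟨ toℚᵘ-toℚ a ⟩
  mkℚᵘ a 0        ≤⟨ *≤* (ℤP.*-monoʳ-≤-nonNeg (+ 1) a≤b) ⟩
  mkℚᵘ b 0        ≃⟨ toℚᵘ-toℚ b ⟨
  ℚ.toℚᵘ (toℚ b)  ∎)
  where open ℚᵘP.≤-Reasoning

toℚ-mono-< : ∀ {a b} → a ℤ.< b → toℚ a < toℚ b
toℚ-mono-< {a} {b} a<b = ℚP.toℚᵘ-cancel-< (begin-strict
  ℚ.toℚᵘ (toℚ a)  ≃⟨ toℚᵘ-toℚ a ⟩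
  mkℚᵘ a 0        <⟨ *<* (ℤP.*-monoʳ-<-pos (+ 1) a<b) ⟩
  mkℚᵘ b 0        ≃⟨ toℚᵘ-toℚ b ⟨
  ℚ.toℚᵘ (toℚ b)  ∎)
  where open ℚᵘP.≤-Reasoning

module ℚ-Group = GroupProperties ℚP.+-0-group

p≤q⇒0≤q-p : ∀ {p q} → p ≤ q → 0ℚ ≤ q - p
p≤q⇒0≤q-p {p} {q} p≤q = subst (_≤ q - p) (ℚP.+-inverseʳ p) (ℚP.+-monoˡ-≤ (- p) p≤q)

p<q⇒0<q-p : ∀ {p q} → p < q → 0ℚ < q - p
p<q⇒0<q-p {p} {q} p<q = subst (_< q - p) (ℚP.+-inverseʳ p) (ℚP.+-monoˡ-< (- p) p<q)

p-q≤0⇒p≤q : ∀ {p q} → p - q ≤ 0ℚ → p ≤ q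
p-q≤0⇒p≤q {p} {q} p-q≤0 = subst₂ _≤_ (solve 2 (λ p q → q :+ (p :- q) := p) refl p q) (ℚP.+-identityʳ q) (ℚP.+-monoʳ-≤ q p-q≤0)

0<q-p⇒p<q : ∀ {p q} → 0ℚ < q - p → p < q
0<q-p⇒p<q {p} {q} 0<q-p = subst₂ _<_ (ℚP.+-identityʳ p) (solve 2 (λ p q → p :+ (q :- p) := q) refl p q) (ℚP.+-monoʳ-< p 0<q-p)

0≤p*q : ∀ {p q} → 0ℚ ≤ p → 0ℚ ≤ q → 0ℚ ≤ p * q
0≤p*q {p} {q} 0≤p 0≤q =
  ℚP.nonNegative⁻¹ (p * q) {{ℚP.nonNeg*nonNeg⇒nonNeg p {{ℚ.nonNegative 0≤p}} q {{ℚ.nonNegative 0≤q}}}}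

module ℤS = ℤSolver.+-*-Solver

i+[j-i]≡j : ∀ i j → i ℤ.+ (j ℤ.- i) ≡ j
i+[j-i]≡j = ℤS.solve 2 (λ i j → i ℤS.:+ (j ℤS.:- i) ℤS.:= j) refl

[i+j]-i≡j : ∀ i j → (i ℤ.+ j) ℤ.- i ≡ j
[i+j]-i≡j = ℤS.solve 2 (λ i j → (i ℤS.:+ j) ℤS.:- i ℤS.:= j) refl

+e*i≤0 : ∀ e {i} → i ℤ.≤ + 0 → + e ℤ.* i ℤ.≤ + 0
+e*i≤0 e {i} i≤0 = subst (+ e ℤ.* i ℤ.≤_) (ℤP.*-zeroʳ (+ e)) (ℤP.*-monoˡ-≤-nonNeg (+ e) i≤0)

+e*[i-j]≤-e : ∀ e {i j} → i ℤ.< j → + e ℤ.* (i ℤ.- j) ℤ.≤ ℤ.- + e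
+e*[i-j]≤-e e {i} {j} i<j = begin
  + e ℤ.* (i ℤ.- j)                      ≡⟨ ℤS.solve 3 (λ e i j → e ℤS.:* (i ℤS.:- j) ℤS.:= e ℤS.:* ((ℤS.con (+ 1) ℤS.:+ i) ℤS.:- j) ℤS.:- e) refl (+ e) i j ⟩
  + e ℤ.* (ℤ.suc i ℤ.- j) ℤ.- + e       ≤⟨ ℤP.+-monoˡ-≤ (ℤ.- + e) (+e*i≤0 e (ℤP.i≤j⇒i-j≤0 (ℤP.i<j⇒suc[i]≤j i<j))) ⟩
  + 0 ℤ.- + e                            ≡⟨ ℤP.+-identityˡ (ℤ.- + e) ⟩
  ℤ.- + e                                ∎
  where
    open ℤP.≤-Reasoning

true≢false : true ≢ false
true≢false ()

does≡true⇒ : ∀ {p} {P : Set p} (P? : Dec P) → does P? ≡ true → P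
does≡true⇒ {P = P} P? eq = invert (subst (Reflects P) eq (proof P?))

total⇒refl : ∀ {a ℓ} {X : Set a} {_≼_ : X → X → Set ℓ} → Total _≼_ → Reflexive _≼_
total⇒refl total {x} with total x x
... | inj₁ r = r
... | inj₂ r = r

argmax : ∀ {a ℓ} {X : Set a} {_≼_ : X → X → Set ℓ} → Total _≼_ → Transitive _≼_ →
         ∀ {n} → Fin n → (f : Fin n → X) → ∃ λ m → ∀ v → f v ≼ f m
argmax total trans′ {suc zero}    _ f = zero , λ { zero → total⇒refl total }
argmax total trans′ {suc (suc n)} _ f with argmax total trans′ zero (f ∘ suc)
... | m , f≼fm with total (f zero) (f (suc m))
...   | inj₁ f0≼fm = suc m , λ { zero → f0≼fm ; (suc v) → f≼fm v }
...   | inj₂ fm≼f0 = zero , λ { zero → total⇒refl total ; (suc v) → trans′ (f≼fm v) fm≼f0 }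

punchIn-cover : ∀ {n} {p} (P : Fin (suc n) → Set p) i → P i → (∀ j → P (punchIn i j)) → ∀ v → P v
punchIn-cover P i Pi Pj v with i Fin.≟ v
... | yes refl = Pi
... | no i≢v   = subst P (FinP.punchIn-punchOut i≢v) (Pj (punchOut i≢v))

-- Finite sums

module ∑ℚ = SemiringSum (CommutativeRing.semiring ℚP.+-*-commutativeRing)

sumℚ≡sum : ∀ {n} (f : Fin n → ℚ) → sumℚ f ≡ ∑ℚ.sum f
sumℚ≡sum {zero}  f = refl
sumℚ≡sum {suc n} f = cong (_+_ (f zero)) (sumℚ≡sum (f ∘ suc))

sumℚ-cong : ∀ {n} {f g : Fin n → ℚ} → (∀ i → f i ≡ g i) → sumℚ f ≡ sumℚ g
sumℚ-cong {f = f} {g} f≗g = trans (sumℚ≡sum f) (trans (∑ℚ.sum-cong-≗ f≗g) (sym (sumℚ≡sum g)))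

sumℚ-+ : ∀ {n} (f g : Fin n → ℚ) → sumℚ (λ i → f i + g i) ≡ sumℚ f + sumℚ g
sumℚ-+ f g = begin
  sumℚ (λ i → f i + g i)   ≡⟨ sumℚ≡sum (λ i → f i + g i) ⟩
  ∑ℚ.sum (λ i → f i + g i) ≡⟨ ∑ℚ.∑-distrib-+ f g ⟩
  ∑ℚ.sum f + ∑ℚ.sum g      ≡⟨ cong₂ _+_ (sumℚ≡sum f) (sumℚ≡sum g) ⟨
  sumℚ f + sumℚ g          ∎
  where open ≡-Reasoning

sumℚ-*ˡ : ∀ {n} c (f : Fin n → ℚ) → sumℚ (λ i → c * f i) ≡ c * sumℚ f
sumℚ-*ˡ c f = begin
  sumℚ (λ i → c * f i)     ≡⟨ sumℚ≡sum (λ i → c * f i) ⟩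
  ∑ℚ.sum (λ i → c * f i)   ≡⟨ ∑ℚ.*-distribˡ-sum c f ⟨
  c * ∑ℚ.sum f             ≡⟨ cong (c *_) (sumℚ≡sum f) ⟨
  c * sumℚ f               ∎
  where open ≡-Reasoning

sumℚ-swap : ∀ {m n} (f : Fin m → Fin n → ℚ) →
            sumℚ (λ i → sumℚ (λ j → f i j)) ≡ sumℚ (λ j → sumℚ (λ i → f i j))
sumℚ-swap f = begin
  sumℚ (λ i → sumℚ (f i))               ≡⟨ sumℚ-cong (λ i → sumℚ≡sum (f i)) ⟩
  sumℚ (λ i → ∑ℚ.sum (f i))             ≡⟨ sumℚ≡sum (λ i → ∑ℚ.sum (f i)) ⟩
  ∑ℚ.sum (λ i → ∑ℚ.sum (f i))           ≡⟨ ∑ℚ.∑-comm f ⟩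
  ∑ℚ.sum (λ j → ∑ℚ.sum (λ i → f i j))   ≡⟨ sumℚ≡sum (λ j → ∑ℚ.sum (λ i → f i j)) ⟨
  sumℚ (λ j → ∑ℚ.sum (λ i → f i j))     ≡⟨ sumℚ-cong (λ j → sumℚ≡sum (λ i → f i j)) ⟨
  sumℚ (λ j → sumℚ (λ i → f i j))       ∎
  where open ≡-Reasoning

sumℚ-punchIn : ∀ {n} (i : Fin (suc n)) (f : Fin (suc n) → ℚ) →
               sumℚ f ≡ f i + sumℚ (f ∘ punchIn i)
sumℚ-punchIn i f = begin
  sumℚ f                     ≡⟨ sumℚ≡sum f ⟩
  ∑ℚ.sum f                   ≡⟨ ∑ℚ.sum-remove f ⟩
  f i + ∑ℚ.sum (f ∘ punchIn i) ≡⟨ cong (_+_ (f i)) (sumℚ≡sum (f ∘ punchIn i)) ⟨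
  f i + sumℚ (f ∘ punchIn i) ∎
  where open ≡-Reasoning

sumℚ-zero : ∀ {n} → sumℚ {n} (λ _ → 0ℚ) ≡ 0ℚ
sumℚ-zero {n} = trans (sumℚ≡sum {n} (λ _ → 0ℚ)) (∑ℚ.sum-replicate-zero n)

sumℚ-const : ∀ {n} c → sumℚ {n} (λ _ → c) ≡ toℚ (+ n) * c
sumℚ-const {zero}  c = sym (ℚP.*-zeroˡ c)
sumℚ-const {suc n} c = begin
  c + sumℚ {n} (λ _ → c)      ≡⟨ cong (_+_ c) (sumℚ-const {n} c) ⟩
  c + toℚ (+ n) * c           ≡⟨ solve 2 (λ c t → c :+ t :* c := (con 1ℚ :+ t) :* c) refl c (toℚ (+ n)) ⟩
  (1ℚ + toℚ (+ n)) * c        ≡⟨ cong (_* c) (toℚ-+ (+ 1) (+ n)) ⟨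
  toℚ (+ suc n) * c           ∎
  where open ≡-Reasoning

sumℚ-neg : ∀ {n} (f : Fin n → ℚ) → sumℚ (λ i → - f i) ≡ - sumℚ f
sumℚ-neg {zero}  f = refl
sumℚ-neg {suc n} f = trans (cong (_+_ (- f zero)) (sumℚ-neg (f ∘ suc))) (sym (ℚP.neg-distrib-+ (f zero) (sumℚ (f ∘ suc))))

sumℚ-- : ∀ {n} (f g : Fin n → ℚ) → sumℚ (λ i → f i - g i) ≡ sumℚ f - sumℚ g
sumℚ-- f g = trans (sumℚ-+ f (λ i → - g i)) (cong (_+_ (sumℚ f)) (sumℚ-neg g))

sumℚ-mono-≤ : ∀ {n} {f g : Fin n → ℚ} → (∀ i → f i ≤ g i) → sumℚ f ≤ sumℚ g
sumℚ-mono-≤ {zero}  f≤g = ℚP.≤-refl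
sumℚ-mono-≤ {suc n} f≤g = ℚP.+-mono-≤ (f≤g zero) (sumℚ-mono-≤ (f≤g ∘ suc))

sumℚ-nonNeg : ∀ {n} (f : Fin n → ℚ) → (∀ i → 0ℚ ≤ f i) → 0ℚ ≤ sumℚ f
sumℚ-nonNeg {n} f 0≤f = subst (_≤ sumℚ f) (sumℚ-zero {n}) (sumℚ-mono-≤ 0≤f)

sumℚ-nonPos : ∀ {n} (f : Fin n → ℚ) → (∀ i → f i ≤ 0ℚ) → sumℚ f ≤ 0ℚ
sumℚ-nonPos {n} f f≤0 = subst (sumℚ f ≤_) (sumℚ-zero {n}) (sumℚ-mono-≤ f≤0)

term≤sumℚ : ∀ {n} (f : Fin n → ℚ) → (∀ i → 0ℚ ≤ f i) → ∀ j → f j ≤ sumℚ f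
term≤sumℚ {suc n} f 0≤f j = begin
  f j                         ≡⟨ ℚP.+-identityʳ (f j) ⟨
  f j + 0ℚ                    ≤⟨ ℚP.+-monoʳ-≤ (f j) (sumℚ-nonNeg (f ∘ punchIn j) (0≤f ∘ punchIn j)) ⟩
  f j + sumℚ (f ∘ punchIn j)  ≡⟨ sumℚ-punchIn j f ⟨
  sumℚ f                      ∎
  where open ℚP.≤-Reasoning

point-self : ∀ {n} (q : Fin n) → point q q ≡ + 1
point-self q with q Fin.≟ q
... | yes _  = refl
... | no q≢q = ⊥-elim (q≢q refl)

point-other : ∀ {n} (q v : Fin n) → q ≢ v → point q v ≡ + 0
point-other q v q≢v with q Fin.≟ v
... | yes q≡v = ⊥-elim (q≢v q≡v)
... | no _    = refl

sumℚ-point : ∀ {n} (q : Fin n) (f : Fin n → ℚ) → sumℚ (λ v → f v * toℚ (point q v)) ≡ f q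
sumℚ-point {suc n} q f = begin
  sumℚ g                                           ≡⟨ sumℚ-punchIn q g ⟩
  f q * toℚ (point q q) + sumℚ (g ∘ punchIn q)     ≡⟨ cong₂ _+_ (cong (λ z → f q * toℚ z) (point-self q)) (sumℚ-cong off-q) ⟩
  f q * 1ℚ + sumℚ {n} (λ _ → 0ℚ)                   ≡⟨ cong₂ _+_ (ℚP.*-identityʳ (f q)) (sumℚ-zero {n}) ⟩
  f q + 0ℚ                                         ≡⟨ ℚP.+-identityʳ (f q) ⟩
  f q                                              ∎
  where
    open ≡-Reasoning
    g : Fin _ → ℚ
    g v = f v * toℚ (point q v)
    off-q : ∀ j → g (punchIn q j) ≡ 0ℚ
    off-q j = trans (cong (λ z → f (punchIn q j) * toℚ z) (point-other q _ (FinP.punchInᵢ≢i q j ∘ sym)))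
                    (ℚP.*-zeroʳ (f (punchIn q j)))

sumℤ-cong : ∀ {n} {f g : Fin n → ℤ} → (∀ i → f i ≡ g i) → sumℤ f ≡ sumℤ g
sumℤ-cong {zero}  f≗g = refl
sumℤ-cong {suc n} f≗g = cong₂ ℤ._+_ (f≗g zero) (sumℤ-cong (f≗g ∘ suc))

sumℤ-mono-≤ : ∀ {n} {f g : Fin n → ℤ} → (∀ i → f i ℤ.≤ g i) → sumℤ f ℤ.≤ sumℤ g
sumℤ-mono-≤ {zero}  f≤g = ℤP.≤-refl
sumℤ-mono-≤ {suc n} f≤g = ℤP.+-mono-≤ (f≤g zero) (sumℤ-mono-≤ (f≤g ∘ suc))

sumℤ-zero : ∀ {n} → sumℤ {n} (λ _ → + 0) ≡ + 0
sumℤ-zero {zero}  = refl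
sumℤ-zero {suc n} = cong (ℤ._+_ (+ 0)) (sumℤ-zero {n})

sumℤ-neg : ∀ {n} (f : Fin n → ℤ) → sumℤ (λ i → ℤ.- f i) ≡ ℤ.- sumℤ f
sumℤ-neg {zero}  f = refl
sumℤ-neg {suc n} f = trans (cong (ℤ._+_ (ℤ.- f zero)) (sumℤ-neg (f ∘ suc))) (sym (ℤP.neg-distrib-+ (f zero) (sumℤ (f ∘ suc))))

sumℤ-pos : ∀ {n} (f : Fin n → ℕ) → sumℤ (λ i → + f i) ≡ + sumℕ f
sumℤ-pos {zero}  f = refl
sumℤ-pos {suc n} f = cong (ℤ._+_ (+ f zero)) (sumℤ-pos (f ∘ suc))

toℚ-sumℤ : ∀ {n} (f : Fin n → ℤ) → toℚ (sumℤ f) ≡ sumℚ (toℚ ∘ f)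
toℚ-sumℤ {zero}  f = refl
toℚ-sumℤ {suc n} f = trans (toℚ-+ (f zero) (sumℤ (f ∘ suc))) (cong (_+_ (toℚ (f zero))) (toℚ-sumℤ (f ∘ suc)))

term≤sumℕ : ∀ {n} (f : Fin n → ℕ) j → f j ℕ.≤ sumℕ f
term≤sumℕ f zero    = ℕP.m≤m+n (f zero) _
term≤sumℕ f (suc j) = ℕP.≤-trans (term≤sumℕ (f ∘ suc) j) (ℕP.m≤n+m _ (f zero))

0<sumℚ : ∀ {n} (f : Fin n → ℚ) → (∀ i → 0ℚ ≤ f i) → ∀ j → 0ℚ < f j → 0ℚ < sumℚ f
0<sumℚ f 0≤f j 0<fj = ℚP.<-≤-trans 0<fj (term≤sumℚ f 0≤f j)

sum≡0⇒head≡-sum-tail : ∀ {m} (g : Fin (suc m) → ℚ) → sumℚ g ≡ 0ℚ → g zero ≡ - sumℚ (g ∘ suc)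
sum≡0⇒head≡-sum-tail g Σg≡0 = begin
  g zero                          ≡⟨ solve 2 (λ a s → a := (a :+ s) :- s) refl (g zero) (sumℚ (g ∘ suc)) ⟩
  sumℚ g - sumℚ (g ∘ suc)         ≡⟨ cong (_- sumℚ (g ∘ suc)) Σg≡0 ⟩
  0ℚ - sumℚ (g ∘ suc)             ≡⟨ ℚP.+-identityˡ (- sumℚ (g ∘ suc)) ⟩
  - sumℚ (g ∘ suc)                ∎
  where open ≡-Reasoning

-- The Laplacian

module _ {n : ℕ} (G : Multigraph n) where

  edgesℚ : Fin n → Fin n → ℚ
  edgesℚ v w = toℚ (+ edges G v w)

  Δℚ-toℚ : ∀ (h : Fin n → ℤ) v → Δℚ G (toℚ ∘ h) v ≡ toℚ (Δℤ G h v)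
  Δℚ-toℚ h v = sym (begin
    toℚ (sumℤ (λ w → + edges G v w ℤ.* (h v ℤ.- h w)))          ≡⟨ toℚ-sumℤ (λ w → + edges G v w ℤ.* (h v ℤ.- h w)) ⟩
    sumℚ (λ w → toℚ (+ edges G v w ℤ.* (h v ℤ.- h w)))          ≡⟨ sumℚ-cong termwise ⟩
    sumℚ (λ w → edgesℚ v w * (toℚ (h v) - toℚ (h w)))           ∎)
    where
      open ≡-Reasoning
      termwise : ∀ w → toℚ (+ edges G v w ℤ.* (h v ℤ.- h w)) ≡ edgesℚ v w * (toℚ (h v) - toℚ (h w))
      termwise w = trans (toℚ-* (+ edges G v w) (h v ℤ.- h w)) (cong (edgesℚ v w *_) (toℚ-- (h v) (h w)))

  Δℚ-- : ∀ (f g : Fin n → ℚ) v → Δℚ G (λ u → f u - g u) v ≡ Δℚ G f v - Δℚ G g v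
  Δℚ-- f g v = trans (sumℚ-cong termwise) (sumℚ-- (λ w → edgesℚ v w * (f v - f w)) (λ w → edgesℚ v w * (g v - g w)))
    where
      termwise : ∀ w → edgesℚ v w * ((f v - g v) - (f w - g w)) ≡ edgesℚ v w * (f v - f w) - edgesℚ v w * (g v - g w)
      termwise w = solve 5 (λ e a b c d → e :* ((a :- b) :- (c :- d)) := e :* (a :- c) :- e :* (b :- d))
                           refl (edgesℚ v w) (f v) (g v) (f w) (g w)

  Δℚ-const : ∀ c v → Δℚ G (λ _ → c) v ≡ 0ℚ
  Δℚ-const c v = trans (sumℚ-cong (λ w → solve 2 (λ e c → e :* (c :- c) := con 0ℚ) refl (edgesℚ v w) c)) (sumℚ-zero {n})

  Δℚ-symmetric : ∀ f g → sumℚ (λ v → f v * Δℚ G g v) ≡ sumℚ (λ v → g v * Δℚ G f v)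
  Δℚ-symmetric f g = begin
    sumℚ (λ v → f v * Δℚ G g v)  ≡⟨ expand f g ⟩
    diagonal f g - cross f g     ≡⟨ cong₂ _-_ (diagonal-comm f g) (cross-comm f g) ⟩
    diagonal g f - cross g f     ≡⟨ expand g f ⟨
    sumℚ (λ v → g v * Δℚ G f v)  ∎
    where
      open ≡-Reasoning
      diagonal cross : (Fin n → ℚ) → (Fin n → ℚ) → ℚ
      diagonal f g = sumℚ (λ v → sumℚ (λ w → edgesℚ v w * (f v * g v)))
      cross    f g = sumℚ (λ v → sumℚ (λ w → edgesℚ v w * (f v * g w)))

      expand : ∀ f g → sumℚ (λ v → f v * Δℚ G g v) ≡ diagonal f g - cross f g
      expand f g = trans (sumℚ-cong row)
                     (sumℚ-- (λ v → sumℚ (λ w → edgesℚ v w * (f v * g v))) (λ v → sumℚ (λ w → edgesℚ v w * (f v * g w))))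
        where
          row : ∀ v → f v * Δℚ G g v ≡ sumℚ (λ w → edgesℚ v w * (f v * g v)) - sumℚ (λ w → edgesℚ v w * (f v * g w))
          row v = trans (sym (sumℚ-*ˡ (f v) (λ w → edgesℚ v w * (g v - g w))))
                        (trans (sumℚ-cong (λ w → solve 4 (λ e a b c → a :* (e :* (b :- c)) := e :* (a :* b) :- e :* (a :* c))
                                                         refl (edgesℚ v w) (f v) (g v) (g w)))
                               (sumℚ-- (λ w → edgesℚ v w * (f v * g v)) (λ w → edgesℚ v w * (f v * g w))))

      diagonal-comm : ∀ f g → diagonal f g ≡ diagonal g f
      diagonal-comm f g = sumℚ-cong (λ v → sumℚ-cong (λ w → cong (edgesℚ v w *_) (ℚP.*-comm (f v) (g v))))

      cross-comm : ∀ f g → cross f g ≡ cross g f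
      cross-comm f g = trans (sumℚ-swap (λ v w → edgesℚ v w * (f v * g w)))
        (sumℚ-cong (λ w → sumℚ-cong (λ v → cong₂ _*_ (cong (toℚ ∘ +_) (edges-sym G v w)) (ℚP.*-comm (f v) (g w)))))

  sumℚ-Δℚ : ∀ g → sumℚ (Δℚ G g) ≡ 0ℚ
  sumℚ-Δℚ g = begin
    sumℚ (Δℚ G g)                      ≡⟨ sumℚ-cong (λ v → ℚP.*-identityˡ (Δℚ G g v)) ⟨
    sumℚ (λ v → 1ℚ * Δℚ G g v)         ≡⟨ Δℚ-symmetric (λ _ → 1ℚ) g ⟩
    sumℚ (λ v → g v * Δℚ G (λ _ → 1ℚ) v) ≡⟨ sumℚ-cong (λ v → trans (cong (g v *_) (Δℚ-const 1ℚ v)) (ℚP.*-zeroʳ (g v))) ⟩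
    sumℚ {n} (λ _ → 0ℚ)                ≡⟨ sumℚ-zero {n} ⟩
    0ℚ                                 ∎
    where open ≡-Reasoning

  1≤edges⇒1≤edgesℚ : ∀ {v w} → 1 ℕ.≤ edges G v w → 1ℚ ≤ edgesℚ v w
  1≤edges⇒1≤edgesℚ 1≤e = toℚ-mono-≤ {+ 1} {+ edges G _ _} (ℤ.+≤+ 1≤e)

  0≤edgesℚ : ∀ v w → 0ℚ ≤ edgesℚ v w
  0≤edgesℚ v w = toℚ-mono-≤ {+ 0} {+ edges G v w} (ℤ.+≤+ ℕ.z≤n)

  harmonic-max-spreads : ∀ (g : Fin n → ℚ) v w → (∀ u → g u ≤ g v) → Δℚ G g v ≡ 0ℚ →
                         1 ℕ.≤ edges G v w → g w ≡ g v
  harmonic-max-spreads g v w g≤gv Δg≡0 1≤e = sym (ℚ-Group.x∙y⁻¹≈ε⇒x≈y (g v) (g w) (ℚP.≤-antisym gv-gw≤0 (0≤gv-g w)))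
    where
      0≤gv-g : ∀ u → 0ℚ ≤ g v - g u
      0≤gv-g u = p≤q⇒0≤q-p (g≤gv u)
      term : Fin n → ℚ
      term u = edgesℚ v u * (g v - g u)
      0≤term : ∀ u → 0ℚ ≤ term u
      0≤term u = 0≤p*q (0≤edgesℚ v u) (0≤gv-g u)
      gv-gw≤0 : g v - g w ≤ 0ℚ
      gv-gw≤0 = begin
        g v - g w               ≡⟨ ℚP.*-identityˡ (g v - g w) ⟨
        1ℚ * (g v - g w)        ≤⟨ ℚP.*-monoʳ-≤-nonNeg (g v - g w) {{ℚ.nonNegative (0≤gv-g w)}} (1≤edges⇒1≤edgesℚ 1≤e) ⟩
        term w                  ≤⟨ term≤sumℚ term 0≤term w ⟩
        Δℚ G g v                ≡⟨ Δg≡0 ⟩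
        0ℚ                      ∎
        where open ℚP.≤-Reasoning

harmonic⇒constant : ∀ {n} (G : Multigraph n) → Connected G → (g : Fin n → ℚ) →
                    (∀ v → Δℚ G g v ≡ 0ℚ) → ∀ u v → g u ≡ g v
harmonic⇒constant G conn g harmonic u v = trans (≡max (conn m u)) (sym (≡max (conn m v)))
  where
    m : Fin _
    m = proj₁ (argmax ℚP.≤-total ℚP.≤-trans u g)
    ≤max : ∀ u → g u ≤ g m
    ≤max = proj₂ (argmax ℚP.≤-total ℚP.≤-trans u g)
    ≡max : ∀ {x} → Reach G m x → g x ≡ g m
    ≡max here = refl
    ≡max (step {v} {w} m↝v 1≤e) = trans (harmonic-max-spreads G g v w g≤gv (harmonic v) 1≤e) (≡max m↝v)
      where
        g≤gv : ∀ u → g u ≤ g v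
        g≤gv u = subst (g u ≤_) (sym (≡max m↝v)) (≤max u)

-- Solving Δf = b over ℚ

Matrix : ℕ → Set
Matrix m = Fin m → Fin m → ℚ

infixl 7 _⊛_
_⊛_ : ∀ {m} → Matrix m → (Fin m → ℚ) → Fin m → ℚ
(M ⊛ x) r = sumℚ (λ c → M r c * x c)

HasNontrivialKernel : ∀ {m} → Matrix m → Set
HasNontrivialKernel {m} M = ∃ λ (x : Fin m → ℚ) → (∀ r → (M ⊛ x) r ≡ 0ℚ) × ∃ λ j → x j ≢ 0ℚ

IsSurjective : ∀ {m} → Matrix m → Set
IsSurjective {m} M = ∀ (b : Fin m → ℚ) → ∃ λ x → ∀ r → (M ⊛ x) r ≡ b r

module Elimination {k} (M : Matrix (suc k)) (i : Fin (suc k)) (pivot≢0 : M i zero ≢ 0ℚ) where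

  instance
    pivot-nonZero : ℚ.NonZero (M i zero)
    pivot-nonZero = ℚ.≢-nonZero pivot≢0

  pivot⁻¹ : ℚ
  pivot⁻¹ = ℚ.1/ M i zero

  factor : Fin k → ℚ
  factor r = M (punchIn i r) zero * pivot⁻¹

  reduced : Matrix k
  reduced r c = M (punchIn i r) (suc c) - factor r * M i (suc c)

  extend : (Fin k → ℚ) → ℚ → Fin (suc k) → ℚ
  extend x b zero    = pivot⁻¹ * (b - sumℚ (λ c → M i (suc c) * x c))
  extend x b (suc c) = x c

  extend-pivot-row : ∀ x b → (M ⊛ extend x b) i ≡ b
  extend-pivot-row x b = begin
    M i zero * (pivot⁻¹ * (b - s)) + s ≡⟨ solve 4 (λ p p⁻¹ b s → p :* (p⁻¹ :* (b :- s)) :+ s := (p :* p⁻¹) :* (b :- s) :+ s)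
                                                 refl (M i zero) pivot⁻¹ b s ⟩
    (M i zero * pivot⁻¹) * (b - s) + s ≡⟨ cong (λ z → z * (b - s) + s) (ℚP.*-inverseʳ (M i zero)) ⟩
    1ℚ * (b - s) + s                    ≡⟨ solve 2 (λ b s → con 1ℚ :* (b :- s) :+ s := b) refl b s ⟩
    b                                   ∎
    where
      open ≡-Reasoning
      s : ℚ
      s = sumℚ (λ c → M i (suc c) * x c)

  extend-other-row : ∀ x b r → (M ⊛ extend x b) (punchIn i r) ≡ (reduced ⊛ x) r + factor r * b
  extend-other-row x b r = sym (begin
    (reduced ⊛ x) r + factor r * b      ≡⟨ cong (_+ factor r * b) reduced-row ⟩
    (t - factor r * s) + factor r * b   ≡⟨ solve 5 (λ a p⁻¹ b s t → (t :- a :* p⁻¹ :* s) :+ a :* p⁻¹ :* b := a :* (p⁻¹ :* (b :- s)) :+ t)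
                                                 refl (M (punchIn i r) zero) pivot⁻¹ b s t ⟩
    (M ⊛ extend x b) (punchIn i r)      ∎)
    where
      open ≡-Reasoning
      s t : ℚ
      s = sumℚ (λ c → M i (suc c) * x c)
      t = sumℚ (λ c → M (punchIn i r) (suc c) * x c)
      reduced-row : (reduced ⊛ x) r ≡ t - factor r * s
      reduced-row = begin
        sumℚ (λ c → (M (punchIn i r) (suc c) - factor r * M i (suc c)) * x c)            ≡⟨ sumℚ-cong (λ c →
             solve 4 (λ u f v y → (u :- f :* v) :* y := u :* y :- f :* (v :* y)) refl (M (punchIn i r) (suc c)) (factor r) (M i (suc c)) (x c)) ⟩
        sumℚ (λ c → M (punchIn i r) (suc c) * x c - factor r * (M i (suc c) * x c))     ≡⟨ sumℚ-- (λ c → M (punchIn i r) (suc c) * x c) (λ c → factor r * (M i (suc c) * x c)) ⟩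
        t - sumℚ (λ c → factor r * (M i (suc c) * x c))                                  ≡⟨ cong (_-_ t) (sumℚ-*ˡ (factor r) (λ c → M i (suc c) * x c)) ⟩
        t - factor r * s                                                                 ∎

first-column-kernel : ∀ {k} (M : Matrix (suc k)) → (∀ r → M r zero ≡ 0ℚ) → HasNontrivialKernel M
first-column-kernel {k} M column≡0 = e₀ , Me₀≡0 , zero , λ ()
  where
    e₀ : Fin (suc k) → ℚ
    e₀ zero    = 1ℚ
    e₀ (suc _) = 0ℚ
    Me₀≡0 : ∀ r → (M ⊛ e₀) r ≡ 0ℚ
    Me₀≡0 r = begin
      M r zero * 1ℚ + sumℚ (λ c → M r (suc c) * 0ℚ) ≡⟨ cong₂ _+_ (ℚP.*-identityʳ (M r zero)) (sumℚ-cong (λ c → ℚP.*-zeroʳ (M r (suc c)))) ⟩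
      M r zero + sumℚ {k} (λ _ → 0ℚ)                ≡⟨ cong₂ _+_ (column≡0 r) (sumℚ-zero {k}) ⟩
      0ℚ                                            ∎
      where open ≡-Reasoning

kernel-or-surjective : ∀ {m} (M : Matrix m) → HasNontrivialKernel M ⊎ IsSurjective M
kernel-or-surjective {zero} M = inj₂ (λ b → (λ ()) , λ ())
kernel-or-surjective {suc k} M with FinP.any? (λ i → ¬? (M i zero ℚP.≟ 0ℚ))
... | no no-pivot = inj₁ (first-column-kernel M column≡0)
  where
    column≡0 : ∀ r → M r zero ≡ 0ℚ
    column≡0 r with M r zero ℚP.≟ 0ℚ
    ... | yes Mr0≡0 = Mr0≡0
    ... | no  Mr0≢0 = ⊥-elim (no-pivot (r , Mr0≢0))
... | yes (i , pivot≢0) with kernel-or-surjective (Elimination.reduced M i pivot≢0)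
...   | inj₁ (x , Rx≡0 , j , xj≢0) = inj₁ (extend x 0ℚ , Mx≡0 , suc j , xj≢0)
  where
    open Elimination M i pivot≢0
    Mx≡0 : ∀ r → (M ⊛ extend x 0ℚ) r ≡ 0ℚ
    Mx≡0 = punchIn-cover _ i (extend-pivot-row x 0ℚ) λ r → begin
      (M ⊛ extend x 0ℚ) (punchIn i r)   ≡⟨ extend-other-row x 0ℚ r ⟩
      (reduced ⊛ x) r + factor r * 0ℚ   ≡⟨ cong₂ _+_ (Rx≡0 r) (ℚP.*-zeroʳ (factor r)) ⟩
      0ℚ                                ∎
      where open ≡-Reasoning
...   | inj₂ reduced-surjective = inj₂ surjective
  where
    open Elimination M i pivot≢0
    surjective : IsSurjective M
    surjective b = extend x (b i) , punchIn-cover _ i (extend-pivot-row x (b i)) λ r → begin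
      (M ⊛ extend x (b i)) (punchIn i r)    ≡⟨ extend-other-row x (b i) r ⟩
      (reduced ⊛ x) r + factor r * b i      ≡⟨ cong (_+ factor r * b i) (proj₂ (reduced-surjective b′) r) ⟩
      b′ r + factor r * b i                 ≡⟨ solve 2 (λ u v → (u :- v) :+ v := u) refl (b (punchIn i r)) (factor r * b i) ⟩
      b (punchIn i r)                       ∎
      where
        open ≡-Reasoning
        b′ : Fin k → ℚ
        b′ r = b (punchIn i r) - factor r * b i
        x : Fin k → ℚ
        x = proj₁ (reduced-surjective b′)

-- A potential vanishing at vertex zero is determined by the equations at the other vertices, a square
-- system L; the equation at zero then holds automatically, as both sides sum to zero.
module ReducedLaplacian {m : ℕ} (G : Multigraph (suc m)) where

  extend₀ : (Fin m → ℚ) → Fin (suc m) → ℚ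
  extend₀ x zero    = 0ℚ
  extend₀ x (suc j) = x j

  degreeℚ : Fin (suc m) → ℚ
  degreeℚ v = sumℚ (edgesℚ G v)

  L : Matrix m
  L i j = degreeℚ (suc i) * toℚ (point i j) - edgesℚ G (suc i) (suc j)

  Δℚ-extend₀ : ∀ x i → Δℚ G (extend₀ x) (suc i) ≡ (L ⊛ x) i
  Δℚ-extend₀ x i = begin
    sumℚ (λ w → e w * (x i - extend₀ x w))                  ≡⟨ sumℚ-cong (λ w → solve 3 (λ e a b → e :* (a :- b) := a :* e :- e :* b)
                                                                                     refl (e w) (x i) (extend₀ x w)) ⟩
    sumℚ (λ w → x i * e w - e w * extend₀ x w)              ≡⟨ sumℚ-- (λ w → x i * e w) (λ w → e w * extend₀ x w) ⟩
    sumℚ (λ w → x i * e w) - sumℚ (λ w → e w * extend₀ x w) ≡⟨ cong₂ _-_ (sumℚ-*ˡ (x i) e) neighbours ⟩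
    x i * degreeℚ v - sumℚ (λ j → e (suc j) * x j)          ≡⟨ cong (_- sumℚ (λ j → e (suc j) * x j)) diagonal ⟨
    sumℚ (λ j → (degreeℚ v * x j) * toℚ (point i j)) - sumℚ (λ j → e (suc j) * x j)
                                                            ≡⟨ sumℚ-- (λ j → (degreeℚ v * x j) * toℚ (point i j)) (λ j → e (suc j) * x j) ⟨
    sumℚ (λ j → (degreeℚ v * x j) * toℚ (point i j) - e (suc j) * x j)
                                                            ≡⟨ sumℚ-cong (λ j → solve 4 (λ d p e y → (d :* y) :* p :- e :* y := (d :* p :- e) :* y)
                                                                                         refl (degreeℚ v) (toℚ (point i j)) (e (suc j)) (x j)) ⟩
    (L ⊛ x) i                                               ∎
    where
      open ≡-Reasoning
      v : Fin (suc m)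
      v = suc i
      e : Fin (suc m) → ℚ
      e = edgesℚ G v
      neighbours : sumℚ (λ w → e w * extend₀ x w) ≡ sumℚ (λ j → e (suc j) * x j)
      neighbours = trans (cong (_+ sumℚ (λ j → e (suc j) * x j)) (ℚP.*-zeroʳ (e zero))) (ℚP.+-identityˡ _)
      diagonal : sumℚ (λ j → (degreeℚ v * x j) * toℚ (point i j)) ≡ x i * degreeℚ v
      diagonal = trans (sumℚ-point i (λ j → degreeℚ v * x j)) (ℚP.*-comm (degreeℚ v) (x i))

Δℚ-onto-degreeZero : ∀ {n} (G : Multigraph n) → Connected G → (b : Fin n → ℚ) → sumℚ b ≡ 0ℚ →
                     ∃ λ f → ∀ v → Δℚ G f v ≡ b v
Δℚ-onto-degreeZero {zero}  G conn b Σb≡0 = (λ ()) , λ ()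
Δℚ-onto-degreeZero {suc m} G conn b Σb≡0 with kernel-or-surjective L
  where open ReducedLaplacian G
... | inj₁ (x , Lx≡0 , j , xj≢0) = ⊥-elim (xj≢0 (harmonic⇒constant G conn (extend₀ x) harmonic (suc j) zero))
  where
    open ReducedLaplacian G
    harmonic∘suc : ∀ i → Δℚ G (extend₀ x) (suc i) ≡ 0ℚ
    harmonic∘suc i = trans (Δℚ-extend₀ x i) (Lx≡0 i)
    harmonic : ∀ v → Δℚ G (extend₀ x) v ≡ 0ℚ
    harmonic (suc i) = harmonic∘suc i
    harmonic zero    = begin
      Δℚ G (extend₀ x) zero                  ≡⟨ sum≡0⇒head≡-sum-tail (Δℚ G (extend₀ x)) (sumℚ-Δℚ G (extend₀ x)) ⟩
      - sumℚ (λ i → Δℚ G (extend₀ x) (suc i)) ≡⟨ cong -_ (trans (sumℚ-cong harmonic∘suc) (sumℚ-zero {m})) ⟩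
      0ℚ                                      ∎
      where open ≡-Reasoning
... | inj₂ L-surjective = extend₀ x , solves
  where
    open ReducedLaplacian G
    x : Fin m → ℚ
    x = proj₁ (L-surjective (b ∘ suc))
    solves∘suc : ∀ i → Δℚ G (extend₀ x) (suc i) ≡ b (suc i)
    solves∘suc i = trans (Δℚ-extend₀ x i) (proj₂ (L-surjective (b ∘ suc)) i)
    solves : ∀ v → Δℚ G (extend₀ x) v ≡ b v
    solves (suc i) = solves∘suc i
    solves zero    = begin
      Δℚ G (extend₀ x) zero                  ≡⟨ sum≡0⇒head≡-sum-tail (Δℚ G (extend₀ x)) (sumℚ-Δℚ G (extend₀ x)) ⟩
      - sumℚ (λ i → Δℚ G (extend₀ x) (suc i)) ≡⟨ cong -_ (sumℚ-cong solves∘suc) ⟩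
      - sumℚ (b ∘ suc)                        ≡⟨ sum≡0⇒head≡-sum-tail b Σb≡0 ⟨
      b zero                                  ∎
      where open ≡-Reasoning

-- Chip firing

−𝟙 : Bool → ℤ
−𝟙 true  = -[1+ 0 ]
−𝟙 false = + 0

−𝟙-≤0 : ∀ b → −𝟙 b ℤ.- + 0 ℤ.≤ + 0
−𝟙-≤0 true  = ℤ.-≤+
−𝟙-≤0 false = ℤP.≤-refl

-- Firing A: every vertex of A sends one chip along each edge leaving A.
fire : ∀ {n} → Multigraph n → (Fin n → Bool) → Div n → Div n
fire G A D v = D v ℤ.+ Δℤ G (−𝟙 ∘ A) v

fire-difference : ∀ {n} (G : Multigraph n) A D v → fire G A D v ℤ.- D v ≡ Δℤ G (−𝟙 ∘ A) v
fire-difference G A D v = [i+j]-i≡j (D v) (Δℤ G (−𝟙 ∘ A) v)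

module _ {n} (G : Multigraph n) where

  sumℤ-outdeg : ∀ (A : Fin n → Bool) v →
                sumℤ (λ w → ℤ.- + (if A w then 0 else edges G v w)) ≡ ℤ.- + outdeg G A v
  sumℤ-outdeg A v = trans (sumℤ-neg (λ w → + (if A w then 0 else edges G v w)))
                          (cong ℤ.-_ (sumℤ-pos (λ w → if A w then 0 else edges G v w)))

  Δℤ-at-minimum : ∀ (h : Fin n → ℤ) (A : Fin n → Bool) v → (∀ w → h v ℤ.≤ h w) →
                  (∀ w → A w ≡ false → h v ℤ.< h w) → Δℤ G h v ℤ.≤ ℤ.- + outdeg G A v
  Δℤ-at-minimum h A v minimal strict = ℤP.≤-trans (sumℤ-mono-≤ term) (ℤP.≤-reflexive (sumℤ-outdeg A v))
    where
      term : ∀ w → + edges G v w ℤ.* (h v ℤ.- h w) ℤ.≤ ℤ.- + (if A w then 0 else edges G v w)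
      term w with A w in Aw
      ... | true  = +e*i≤0 (edges G v w) (ℤP.i≤j⇒i-j≤0 (minimal w))
      ... | false = +e*[i-j]≤-e (edges G v w) (strict w Aw)

  Δℤ-fire-inside : ∀ (A : Fin n → Bool) v → A v ≡ true → Δℤ G (−𝟙 ∘ A) v ≡ ℤ.- + outdeg G A v
  Δℤ-fire-inside A v Av = trans (sumℤ-cong term) (sumℤ-outdeg A v)
    where
      term : ∀ w → + edges G v w ℤ.* (−𝟙 (A v) ℤ.- −𝟙 (A w)) ≡ ℤ.- + (if A w then 0 else edges G v w)
      term w rewrite Av with A w
      ... | true  = ℤP.*-zeroʳ (+ edges G v w)
      ... | false = trans (ℤP.*-comm (+ edges G v w) -[1+ 0 ]) (ℤP.-1*i≡-i (+ edges G v w))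

  Δℤ-fire-outside : ∀ (A : Fin n → Bool) v → A v ≡ false → + 0 ℤ.≤ Δℤ G (−𝟙 ∘ A) v
  Δℤ-fire-outside A v Av = subst (ℤ._≤ Δℤ G (−𝟙 ∘ A) v) (sumℤ-zero {n}) (sumℤ-mono-≤ term)
    where
      term : ∀ w → + 0 ℤ.≤ + edges G v w ℤ.* (−𝟙 (A v) ℤ.- −𝟙 (A w))
      term w rewrite Av with A w
      ... | true  = subst (+ 0 ℤ.≤_) (sym (ℤP.*-identityʳ (+ edges G v w))) (ℤ.+≤+ ℕ.z≤n)
      ... | false = ℤP.≤-reflexive (sym (ℤP.*-zeroʳ (+ edges G v w)))

  Δℤ-constant : ∀ (h : Fin n → ℤ) c → (∀ v → h v ≡ c) → ∀ v → Δℤ G h v ≡ + 0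
  Δℤ-constant h c h≡c v = trans (sumℤ-cong term) (sumℤ-zero {n})
    where
      term : ∀ w → + edges G v w ℤ.* (h v ℤ.- h w) ≡ + 0
      term w rewrite h≡c v | h≡c w = trans (cong (+ edges G v w ℤ.*_) (ℤP.+-inverseʳ c)) (ℤP.*-zeroʳ (+ edges G v w))

  leaving-edge : ∀ (A : Fin n → Bool) {u x} → Reach G u x → A u ≡ true → A x ≡ false →
                 ∃ λ v → A v ≡ true × 1 ℕ.≤ outdeg G A v
  leaving-edge A here Au Ax = ⊥-elim (true≢false (trans (sym Au) Ax))
  leaving-edge A (step {v} {w} u↝v 1≤e) Au Aw with A v in Av
  ... | true  = v , Av , ℕP.≤-trans (subst (λ b → 1 ℕ.≤ (if b then 0 else edges G v w)) (sym Aw) 1≤e)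
                                    (term≤sumℕ (λ w → if A w then 0 else edges G v w) w)
  ... | false = leaving-edge A u↝v Au Av

InLinSys-refl : ∀ {n} (G : Multigraph n) q (D : Div n) → (∀ v → v ≢ q → + 0 ℤ.≤ D v) → InLinSys G q D D
InLinSys-refl G q D D≥0 = ((λ _ → + 0) , D-D≡Δ0) , D≥0
  where
    D-D≡Δ0 : ∀ v → D v ℤ.- D v ≡ Δℤ G (λ _ → + 0) v
    D-D≡Δ0 v = trans (ℤP.+-inverseʳ (D v)) (sym (Δℤ-constant G (λ _ → + 0) (+ 0) (λ _ → refl) v))

-- The energy b_q

degreeZeroPart : ∀ {n} → Fin n → Div n → Fin n → ℚ
degreeZeroPart q X v = toℚ ((X -D (deg X ·D point q)) v)

degreeZeroPart-unfold : ∀ {n} (q : Fin n) X v → degreeZeroPart q X v ≡ toℚ (X v) - toℚ (deg X) * toℚ (point q v)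
degreeZeroPart-unfold q X v = trans (toℚ-- (X v) (deg X ℤ.* point q v)) (cong (_-_ (toℚ (X v))) (toℚ-* (deg X) (point q v)))

sumℚ-degreeZeroPart : ∀ {n} (q : Fin n) X → sumℚ (degreeZeroPart q X) ≡ 0ℚ
sumℚ-degreeZeroPart q X = begin
  sumℚ (degreeZeroPart q X)                                  ≡⟨ sumℚ-cong (degreeZeroPart-unfold q X) ⟩
  sumℚ (λ v → toℚ (X v) - toℚ (deg X) * toℚ (point q v))     ≡⟨ sumℚ-- (toℚ ∘ X) (λ v → toℚ (deg X) * toℚ (point q v)) ⟩
  sumℚ (toℚ ∘ X) - sumℚ (λ v → toℚ (deg X) * toℚ (point q v)) ≡⟨ cong₂ _-_ (toℚ-sumℤ X) (sym (sumℚ-point q (λ _ → toℚ (deg X)))) ⟨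
  toℚ (deg X) - toℚ (deg X)                                  ≡⟨ ℚP.+-inverseʳ (toℚ (deg X)) ⟩
  0ℚ                                                         ∎
  where open ≡-Reasoning

deg-one : ∀ {n} → deg {n} one ≡ + n
deg-one {zero}  = refl
deg-one {suc n} = cong (ℤ._+_ (+ 1)) (deg-one {n})

Bq-exists : ∀ {n} (G : Multigraph n) → Connected G → ∀ q X → ∃ (Bq G q X)
Bq-exists G conn q X with Δℚ-onto-degreeZero G conn (degreeZeroPart q one) (sumℚ-degreeZeroPart q one)
... | f , Δf≡1-n·q = sumℚ (λ v → f v * degreeZeroPart q X v) , f , Δf≡1-n·q , refl

module _ {n} (G : Multigraph n) (conn : Connected G) (q : Fin n) {D D′ : Div n} (h : Fin n → ℤ)
         (D′-D≡Δh : ∀ v → D′ v ℤ.- D v ≡ Δℤ G h v) where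

  D′≡D+Δh : ∀ v → D′ v ≡ D v ℤ.+ Δℤ G h v
  D′≡D+Δh v = trans (sym (i+[j-i]≡j (D v) (D′ v))) (cong (ℤ._+_ (D v)) (D′-D≡Δh v))

  private
    hℚ : Fin n → ℚ
    hℚ = toℚ ∘ h

    toℚ-D′≡D+Δh : ∀ v → toℚ (D′ v) ≡ toℚ (D v) + Δℚ G hℚ v
    toℚ-D′≡D+Δh v = begin
      toℚ (D′ v)                    ≡⟨ cong toℚ (D′≡D+Δh v) ⟩
      toℚ (D v ℤ.+ Δℤ G h v)        ≡⟨ toℚ-+ (D v) (Δℤ G h v) ⟩
      toℚ (D v) + toℚ (Δℤ G h v)    ≡⟨ cong (_+_ (toℚ (D v))) (Δℚ-toℚ G h v) ⟨
      toℚ (D v) + Δℚ G hℚ v         ∎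
      where open ≡-Reasoning

    deg-D′ : toℚ (deg D′) ≡ toℚ (deg D)
    deg-D′ = begin
      toℚ (deg D′)                          ≡⟨ toℚ-sumℤ D′ ⟩
      sumℚ (toℚ ∘ D′)                       ≡⟨ sumℚ-cong toℚ-D′≡D+Δh ⟩
      sumℚ (λ v → toℚ (D v) + Δℚ G hℚ v)    ≡⟨ sumℚ-+ (toℚ ∘ D) (Δℚ G hℚ) ⟩
      sumℚ (toℚ ∘ D) + sumℚ (Δℚ G hℚ)       ≡⟨ cong₂ _+_ (toℚ-sumℤ D) (sym (sumℚ-Δℚ G hℚ)) ⟨
      toℚ (deg D) + 0ℚ                      ≡⟨ ℚP.+-identityʳ (toℚ (deg D)) ⟩
      toℚ (deg D)                           ∎
      where open ≡-Reasoning

    degreeZeroPart-D′ : ∀ v → degreeZeroPart q D′ v ≡ degreeZeroPart q D v + Δℚ G hℚ v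
    degreeZeroPart-D′ v = begin
      degreeZeroPart q D′ v                                   ≡⟨ degreeZeroPart-unfold q D′ v ⟩
      toℚ (D′ v) - toℚ (deg D′) * p                           ≡⟨ cong₂ (λ a b → a - b * p) (toℚ-D′≡D+Δh v) deg-D′ ⟩
      (toℚ (D v) + Δℚ G hℚ v) - toℚ (deg D) * p               ≡⟨ solve 4 (λ a d g p → (a :+ d) :- g :* p := (a :- g :* p) :+ d)
                                                                        refl (toℚ (D v)) (Δℚ G hℚ v) (toℚ (deg D)) p ⟩
      (toℚ (D v) - toℚ (deg D) * p) + Δℚ G hℚ v               ≡⟨ cong (_+ Δℚ G hℚ v) (degreeZeroPart-unfold q D v) ⟨
      degreeZeroPart q D v + Δℚ G hℚ v                        ∎
      where
        open ≡-Reasoning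
        p : ℚ
        p = toℚ (point q v)

    potentials-differ-by-constant : ∀ {f f′} → (∀ v → Δℚ G f v ≡ degreeZeroPart q one v) →
                                    (∀ v → Δℚ G f′ v ≡ degreeZeroPart q one v) → ∀ v → f′ v ≡ f v + (f′ q - f q)
    potentials-differ-by-constant {f} {f′} Δf Δf′ v = begin
      f′ v                   ≡⟨ solve 2 (λ a b → a := b :+ (a :- b)) refl (f′ v) (f v) ⟩
      f v + (f′ v - f v)     ≡⟨ cong (_+_ (f v)) (harmonic⇒constant G conn (λ u → f′ u - f u) harmonic v q) ⟩
      f v + (f′ q - f q)     ∎
      where
        open ≡-Reasoning
        harmonic : ∀ u → Δℚ G (λ u → f′ u - f u) u ≡ 0ℚ
        harmonic u = trans (Δℚ-- G f′ f u) (trans (cong₂ _-_ (Δf′ u) (Δf u)) (ℚP.+-inverseʳ (degreeZeroPart q one u)))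

    degreeZeroPart-one : ∀ v → degreeZeroPart q one v ≡ 1ℚ - toℚ (+ n) * toℚ (point q v)
    degreeZeroPart-one v = trans (degreeZeroPart-unfold q one v) (cong (λ d → 1ℚ - toℚ d * toℚ (point q v)) (deg-one {n}))

  Bq-difference : ∀ {r r′} → Bq G q D r → Bq G q D′ r′ → r′ - r ≡ sumℚ (λ v → toℚ (h v) - toℚ (h q))
  Bq-difference (f , Δf , refl) (f′ , Δf′ , refl) = begin
    sumℚ (λ v → f′ v * E′ v) - sumℚ (λ v → f v * E v)   ≡⟨ sumℚ-- (λ v → f′ v * E′ v) (λ v → f v * E v) ⟨
    sumℚ (λ v → f′ v * E′ v - f v * E v)               ≡⟨ sumℚ-cong pointwise ⟩
    sumℚ (λ v → c * E′ v + f v * Δℚ G hℚ v)            ≡⟨ sumℚ-+ (λ v → c * E′ v) (λ v → f v * Δℚ G hℚ v) ⟩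
    sumℚ (λ v → c * E′ v) + sumℚ (λ v → f v * Δℚ G hℚ v) ≡⟨ cong₂ _+_ cE′-vanishes (Δℚ-symmetric G f hℚ) ⟩
    0ℚ + sumℚ (λ v → hℚ v * Δℚ G f v)                  ≡⟨ ℚP.+-identityˡ _ ⟩
    sumℚ (λ v → hℚ v * Δℚ G f v)                       ≡⟨ sumℚ-cong (λ v → cong (hℚ v *_) (trans (Δf v) (degreeZeroPart-one v))) ⟩
    sumℚ (λ v → hℚ v * (1ℚ - N * toℚ (point q v)))     ≡⟨ sumℚ-cong (λ v → solve 3 (λ a N p → a :* (con 1ℚ :- N :* p) := a :- N :* (a :* p))
                                                                                    refl (hℚ v) N (toℚ (point q v))) ⟩
    sumℚ (λ v → hℚ v - N * (hℚ v * toℚ (point q v)))   ≡⟨ sumℚ-- hℚ (λ v → N * (hℚ v * toℚ (point q v))) ⟩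
    sumℚ hℚ - sumℚ (λ v → N * (hℚ v * toℚ (point q v))) ≡⟨ cong (_-_ (sumℚ hℚ)) (trans (sumℚ-*ˡ N (λ v → hℚ v * toℚ (point q v)))
                                                                                       (cong (N *_) (sumℚ-point q hℚ))) ⟩
    sumℚ hℚ - N * hℚ q                                 ≡⟨ cong (_-_ (sumℚ hℚ)) (sumℚ-const {n} (hℚ q)) ⟨
    sumℚ hℚ - sumℚ {n} (λ _ → hℚ q)                    ≡⟨ sumℚ-- hℚ (λ _ → hℚ q) ⟨
    sumℚ (λ v → hℚ v - hℚ q)                           ∎
    where
      open ≡-Reasoning
      E E′ : Fin n → ℚ
      E  = degreeZeroPart q D
      E′ = degreeZeroPart q D′
      N c : ℚ
      N = toℚ (+ n)
      c = f′ q - f q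
      pointwise : ∀ v → f′ v * E′ v - f v * E v ≡ c * E′ v + f v * Δℚ G hℚ v
      pointwise v = begin
        f′ v * E′ v - f v * E v                           ≡⟨ cong₂ (λ a b → a * b - f v * E v) (potentials-differ-by-constant {f} {f′} Δf Δf′ v)
                                                                                              (degreeZeroPart-D′ v) ⟩
        (f v + c) * (E v + Δℚ G hℚ v) - f v * E v          ≡⟨ solve 4 (λ a c e d → (a :+ c) :* (e :+ d) :- a :* e := c :* (e :+ d) :+ a :* d)
                                                                  refl (f v) c (E v) (Δℚ G hℚ v) ⟩
        c * (E v + Δℚ G hℚ v) + f v * Δℚ G hℚ v            ≡⟨ cong (λ e → c * e + f v * Δℚ G hℚ v) (degreeZeroPart-D′ v) ⟨
        c * E′ v + f v * Δℚ G hℚ v                        ∎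
      cE′-vanishes : sumℚ (λ v → c * E′ v) ≡ 0ℚ
      cE′-vanishes = trans (sumℚ-*ˡ c E′) (trans (cong (c *_) (sumℚ-degreeZeroPart q D′)) (ℚP.*-zeroʳ c))

  -- Otherwise the minimum level set of h avoids q, and the vertex of it given by Dhar's criterion goes negative in D′.
  reduced⇒minimum-at-q : IsReduced G q D → (∀ v → v ≢ q → + 0 ℤ.≤ D′ v) → ∀ v → h q ℤ.≤ h v
  reduced⇒minimum-at-q (_ , dhar) D′≥0 v = subst (ℤ._≤ h v) (sym hq≡hm) (minimal v)
    where
      argmin : ∃ λ m → ∀ v → h m ℤ.≤ h v
      argmin = argmax (λ x y → ℤP.≤-total y x) (λ x≥y y≥z → ℤP.≤-trans y≥z x≥y) q h
      m : Fin n
      m = proj₁ argmin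
      minimal : ∀ v → h m ℤ.≤ h v
      minimal = proj₂ argmin

      A : Fin n → Bool
      A v = does (h v ℤP.≟ h m)

      hq≡hm : h q ≡ h m
      hq≡hm with h q ℤP.≟ h m
      ... | yes hq≡hm = hq≡hm
      ... | no  hq≢hm with dhar A (dec-false (h q ℤP.≟ h m) hq≢hm) (m , dec-true (h m ℤP.≟ h m) refl)
      ...   | u , Au , Du<outdeg = ⊥-elim (ℤP.<-irrefl refl (ℤP.≤-<-trans (D′≥0 u u≢q) D′u<0))
        where
          hu≡hm : h u ≡ h m
          hu≡hm = does≡true⇒ (h u ℤP.≟ h m) Au
          u≢q : u ≢ q
          u≢q u≡q = hq≢hm (trans (cong h (sym u≡q)) hu≡hm)
          above-level : ∀ w → A w ≡ false → h u ℤ.< h w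
          above-level w Aw = subst (ℤ._< h w) (sym hu≡hm) (ℤP.≤∧≢⇒< (minimal w) λ hm≡hw →
                               true≢false (trans (sym (dec-true (h w ℤP.≟ h m) (sym hm≡hw))) Aw))
          o : ℤ
          o = + outdeg G A u
          D′u<0 : D′ u ℤ.< + 0
          D′u<0 = begin-strict
            D′ u               ≡⟨ D′≡D+Δh u ⟩
            D u ℤ.+ Δℤ G h u   ≤⟨ ℤP.+-monoʳ-≤ (D u) (Δℤ-at-minimum G h A u (λ w → subst (ℤ._≤ h w) (sym hu≡hm) (minimal w)) above-level) ⟩
            D u ℤ.- o          <⟨ ℤP.+-monoˡ-< (ℤ.- o) Du<outdeg ⟩
            o ℤ.- o            ≡⟨ ℤP.+-inverseʳ o ⟩
            + 0                ∎
            where open ℤP.≤-Reasoning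

  reduced⇒Bq-less : IsReduced G q D → (∀ v → v ≢ q → + 0 ℤ.≤ D′ v) → ¬ (∀ v → D′ v ≡ D v) → BqLess G q D D′
  reduced⇒Bq-less reduced D′≥0 D′≢D r r′ Bq-r Bq-r′ =
    0<q-p⇒p<q (subst (0ℚ <_) (sym (Bq-difference Bq-r Bq-r′)) (0<sumℚ _ 0≤h-hq u 0<hu-hq))
    where
      hq≤h : ∀ v → h q ℤ.≤ h v
      hq≤h = reduced⇒minimum-at-q reduced D′≥0
      0≤h-hq : ∀ v → 0ℚ ≤ toℚ (h v) - toℚ (h q)
      0≤h-hq v = p≤q⇒0≤q-p (toℚ-mono-≤ (hq≤h v))
      nonconstant : ¬ (∀ v → h v ≡ h q)
      nonconstant h≡hq = D′≢D (λ v → ℤP.i-j≡0⇒i≡j _ _ (trans (D′-D≡Δh v) (Δℤ-constant G h (h q) h≡hq v)))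
      nonminimal : ∃ λ u → h u ≢ h q
      nonminimal = FinP.¬∀⟶∃¬ n _ (λ v → h v ℤP.≟ h q) nonconstant
      u : Fin n
      u = proj₁ nonminimal
      0<hu-hq : 0ℚ < toℚ (h u) - toℚ (h q)
      0<hu-hq = p<q⇒0<q-p (toℚ-mono-< (ℤP.≤∧≢⇒< (hq≤h u) (proj₂ nonminimal ∘ sym)))

BqMinimal : ∀ {n} → Multigraph n → Fin n → Div n → Set
BqMinimal {n} G q D = InLinSys G q D D × (∀ (D′ : Div n) → InLinSys G q D D′ → ¬ (∀ v → D′ v ≡ D v) → BqLess G q D D′)

module _ {n} (G : Multigraph n) (conn : Connected G) (q : Fin n) (D : Div n) (A : Fin n → Bool) (Aq : A q ≡ false) where

  fire-Bq-not-larger : ¬ BqLess G q D (fire G A D)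
  fire-Bq-not-larger Bq-less with Bq-exists G conn q D | Bq-exists G conn q (fire G A D)
  ... | r , Bq-r | r′ , Bq-r′ = ℚP.<-irrefl refl (ℚP.<-≤-trans (Bq-less r r′ Bq-r Bq-r′) (p-q≤0⇒p≤q r′-r≤0))
    where
      term≤0 : ∀ v → toℚ (−𝟙 (A v)) - toℚ (−𝟙 (A q)) ≤ 0ℚ
      term≤0 v rewrite Aq = subst (_≤ 0ℚ) (toℚ-- (−𝟙 (A v)) (+ 0)) (toℚ-mono-≤ {_} {+ 0} (−𝟙-≤0 (A v)))
      r′-r≤0 : r′ - r ≤ 0ℚ
      r′-r≤0 = subst (_≤ 0ℚ) (sym (Bq-difference G conn q {D} {fire G A D} (−𝟙 ∘ A) (fire-difference G A D) Bq-r Bq-r′))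
                     (sumℚ-nonPos _ term≤0)

  fire-stays-effective : (∀ v → v ≢ q → + 0 ℤ.≤ D v) → (∀ v → A v ≡ true → + outdeg G A v ℤ.≤ D v) →
                         ∀ v → v ≢ q → + 0 ℤ.≤ fire G A D v
  fire-stays-effective D≥0 stable v v≢q = by-membership (A v) refl
    where
      by-membership : ∀ b → A v ≡ b → + 0 ℤ.≤ fire G A D v
      by-membership true Av = begin
        + 0            ≡⟨ ℤP.+-inverseʳ o ⟨
        o ℤ.- o        ≤⟨ ℤP.+-monoˡ-≤ (ℤ.- o) (stable v Av) ⟩
        D v ℤ.- o      ≡⟨ cong (ℤ._+_ (D v)) (Δℤ-fire-inside G A v Av) ⟨
        fire G A D v   ∎
        where
          open ℤP.≤-Reasoning
          o : ℤ
          o = + outdeg G A v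
      by-membership false Av = begin
        + 0                        ≤⟨ D≥0 v v≢q ⟩
        D v                        ≡⟨ ℤP.+-identityʳ (D v) ⟨
        D v ℤ.+ + 0                ≤⟨ ℤP.+-monoʳ-≤ (D v) (Δℤ-fire-outside G A v Av) ⟩
        fire G A D v               ∎
        where open ℤP.≤-Reasoning

  fire-moves : ∀ {u} → A u ≡ true → ¬ (∀ v → fire G A D v ≡ D v)
  fire-moves {u} Au unchanged with leaving-edge G A (conn u q) Au Aq
  ... | v , Av , 1≤outdeg = ℕP.<⇒≢ 1≤outdeg (sym (ℤP.+-injective (ℤP.neg-injective outdeg≡0)))
    where
      outdeg≡0 : ℤ.- + outdeg G A v ≡ ℤ.- + 0
      outdeg≡0 = begin
        ℤ.- + outdeg G A v          ≡⟨ Δℤ-fire-inside G A v Av ⟨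
        Δℤ G (−𝟙 ∘ A) v             ≡⟨ fire-difference G A D v ⟨
        fire G A D v ℤ.- D v        ≡⟨ ℤP.i≡j⇒i-j≡0 (unchanged v) ⟩
        + 0                         ∎
        where open ≡-Reasoning

  Bq-minimal⇒unstable : BqMinimal G q D → ∀ {u} → A u ≡ true → ∃ λ v → A v ≡ true × D v ℤ.< + outdeg G A v
  Bq-minimal⇒unstable ((_ , D≥0) , minimal) {u} Au with FinP.any? (λ v → (A v Bool.≟ true) ×-dec (D v ℤ.<? + outdeg G A v))
  ... | yes unstable = unstable
  ... | no  stable   = ⊥-elim (fire-Bq-not-larger (minimal (fire G A D) fire∈|D| (fire-moves Au)))
    where
      fire∈|D| : InLinSys G q D (fire G A D)
      fire∈|D| = ((−𝟙 ∘ A) , fire-difference G A D) ,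
                 fire-stays-effective D≥0 (λ v Av → ℤP.≮⇒≥ (λ D<outdeg → stable (v , Av , D<outdeg)))

theorem4p13 : ∀ {n : ℕ} (G : Multigraph n) → Connected G → (q : Fin n) → (D : Div n) →
    IsReduced G q D ⇔
      (InLinSys G q D D ×
       (∀ (D' : Div n) → InLinSys G q D D' → ¬ (∀ v → D' v ≡ D v) → BqLess G q D D'))
theorem4p13 G conn q D = mk⇔ reduced⇒minimal minimal⇒reduced
  where
    reduced⇒minimal : IsReduced G q D → BqMinimal G q D
    reduced⇒minimal reduced@(D≥0 , _) =
      InLinSys-refl G q D D≥0 ,
      λ { D′ ((h , D′-D≡Δh) , D′≥0) → reduced⇒Bq-less G conn q h D′-D≡Δh reduced D′≥0 }
    minimal⇒reduced : BqMinimal G q D → IsReduced G q D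
    minimal⇒reduced minimal@((_ , D≥0) , _) =
      D≥0 , λ A Aq (_ , Au) → Bq-minimal⇒unstable G conn q D A Aq minimal Au
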